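{- Let $G_S=(S,N,E_S)$ be a bipartite graph with no isolated vertices, let $\gamma=|N|$, and let $\delta=\frac1\gamma\sum_{v\in N}\deg(v,S)$ be the average degree of a vertex of $N$. Then there is a subset $S'\subseteq S$ with $|\Gamma^1_S(S')|\geq\gamma/(8\delta)$.
   Context: $\deg(v,S)$ is the number of neighbors of $v$ in $S$. For $S'\subseteq S$, $\Gamma^1_S(S')$ is the set of vertices outside $S$ (i.e. in $N$) that have exactly one neighbor in $S'$. -}

module Defs where

open import Data.Nat using (ℕ; _≡ᵇ_)
open import Data.Bool using (Bool; true)
open import Data.Fin using (Fin)
open import Data.Fin.Subset using (Subset; _∩_; ∣_∣; ⊤)
open import Data.Vec using (tabulate; sum)
open import Data.Product using (∃)
open import Data.Product using (_×_)
open import Relation.Binary.PropositionalEquality using (_≡_)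

-- A bipartite graph G_S = (S, N, E_S) with S = Fin s and N = Fin n;
-- E u v ≡ true iff u ∈ S and v ∈ N are adjacent.
BipGraph : ℕ → ℕ → Set
BipGraph s n = Fin s → Fin n → Bool

nbrS : ∀ {s n} → BipGraph s n → Fin n → Subset s
nbrS E v = tabulate (λ u → E u v)

deg : ∀ {s n} → BipGraph s n → Fin n → Subset s → ℕ
deg E v S' = ∣ S' ∩ nbrS E v ∣

Γ¹ : ∀ {s n} → BipGraph s n → Subset s → Subset n
Γ¹ E S' = tabulate (λ v → deg E v S' ≡ᵇ 1)

NoIsolated : ∀ {s n} → BipGraph s n → Set
NoIsolated E = (∀ u → ∃ λ v → E u v ≡ true) × (∀ v → ∃ λ u → E u v ≡ true)

-- Σ_{v ∈ N} deg(v, S)  (= γ · δ)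
degSum : ∀ {s n} → BipGraph s n → ℕ
degSum {n = n} E = sum (tabulate (λ v → deg E v ⊤))

-- The proof is the probabilistic method, derandomised into integer
-- arithmetic.  Put every u ∈ S into S' independently with probability 1/q,
-- where q = p + 1.  Instead of probabilities we give a subset T ⊆ S the
-- integer weight p^|S ∖ T|; the total weight is q^|S|, so some T has
-- q^|S| · f(T) at least the weighted sum of f (the averaging principle).
--
-- A vertex v ∈ N of degree d is hit exactly once with probability
-- d(1 - 1/q)^(d-1)/q, and a Bernoulli inequality bounds this from below by
-- d(q + 1 - d)/q².  Summing over N, some S' satisfies
--   q² · |Γ¹(S')| ≥ Σ_v d_v (q + 1 - d_v) ≥ q·γ - D,     D = Σ_v d_v = γδ.
-- Choosing q with 2D ≤ qγ ≤ 3D (possible as γ ≤ D) makes q²γ² ≤ 8D(qγ - D),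
-- which gives γ² ≤ 8 D |Γ¹(S')|.
module Submission where

open import Defs
open import Data.Nat using (ℕ; _*_; _≤_)
open import Data.Fin.Subset using (Subset; ∣_∣)
open import Data.Product using (∃)
open import Data.Nat using (zero; suc; _+_; _∸_; _^_; _≡ᵇ_; _/_; _%_; _≤?_; z≤n)
open import Data.Nat.Properties
open import Data.Nat.DivMod using (m/n*n≤m; m≡m%n+[m/n]*n; m%n<n)
open import Data.Nat.Tactic.RingSolver using (solve-∀)
open import Algebra.Properties.CommutativeSemigroup *-commutativeSemigroup
  using (x∙yz≈y∙xz; xy∙z≈y∙xz; x∙yz≈y∙zx)
open import Data.Bool using (Bool; true; false)
open import Data.Fin using (Fin) renaming (zero to fzero; suc to fsuc)
open import Data.Fin.Subset using (_∩_; ⊤; ∁)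
open import Data.Fin.Subset.Properties using (∩-identityˡ; ∣p∣≤n; ∣∁p∣≡n∸∣p∣)
open import Data.Vec using ([]; _∷_; tabulate; sum)
open import Data.Product using (_,_; _×_)
open import Function using (_∘_)
open import Relation.Nullary using (yes; no)
open import Relation.Binary.PropositionalEquality
  using (_≡_; refl; sym; trans; cong; cong₂; module ≡-Reasoning)

𝟙 : Bool → ℕ
𝟙 true  = 1
𝟙 false = 0

Σ[_] : ∀ {n} → (Fin n → ℕ) → ℕ
Σ[ f ] = sum (tabulate f)

Σ-mono : ∀ {n} {f g : Fin n → ℕ} → (∀ v → f v ≤ g v) → Σ[ f ] ≤ Σ[ g ]
Σ-mono {zero}  le = z≤n
Σ-mono {suc n} le = +-mono-≤ (le fzero) (Σ-mono (le ∘ fsuc))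

Σ-scale : ∀ {n} c (f : Fin n → ℕ) → Σ[ (λ v → c * f v) ] ≡ c * Σ[ f ]
Σ-scale {zero}  c f = sym (*-zeroʳ c)
Σ-scale {suc n} c f =
  trans (cong (c * f fzero +_) (Σ-scale c (f ∘ fsuc))) (sym (*-distribˡ-+ c (f fzero) _))

Σ-+ : ∀ {n} (f g : Fin n → ℕ) → Σ[ (λ v → f v + g v) ] ≡ Σ[ f ] + Σ[ g ]
Σ-+ {zero}  f g = refl
Σ-+ {suc n} f g =
  trans (cong (f fzero + g fzero +_) (Σ-+ (f ∘ fsuc) (g ∘ fsuc)))
        (+-exchange (f fzero) (g fzero) Σ[ f ∘ fsuc ] Σ[ g ∘ fsuc ])
  where
  +-exchange : ∀ a b c d → a + b + (c + d) ≡ a + c + (b + d)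
  +-exchange = solve-∀

Σ-const : ∀ n c → Σ[ (λ (_ : Fin n) → c) ] ≡ n * c
Σ-const zero    c = refl
Σ-const (suc n) c = cong (c +_) (Σ-const n c)

∣tabulate∣ : ∀ {n} (b : Fin n → Bool) → ∣ tabulate b ∣ ≡ Σ[ 𝟙 ∘ b ]
∣tabulate∣ {zero}  b = refl
∣tabulate∣ {suc n} b with b fzero
... | true  = cong suc (∣tabulate∣ (b ∘ fsuc))
... | false = ∣tabulate∣ (b ∘ fsuc)

∣tabulate∣-positive : ∀ {n} (b : Fin n → Bool) u → b u ≡ true → 1 ≤ ∣ tabulate b ∣
∣tabulate∣-positive b u bu≡true =
  ≤-trans (≤-reflexive (sym (cong 𝟙 bu≡true))) (≤-trans (term≤Σ u) (≤-reflexive (sym (∣tabulate∣ b))))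
  where
  term≤Σ : ∀ {n} {f : Fin n → ℕ} v → f v ≤ Σ[ f ]
  term≤Σ fzero    = m≤m+n _ _
  term≤Σ {f = f} (fsuc v) = ≤-trans (term≤Σ v) (m≤n+m _ (f fzero))

∣p∣+∣∁p∣ : ∀ {s} (A : Subset s) → ∣ A ∣ + ∣ ∁ A ∣ ≡ s
∣p∣+∣∁p∣ A = trans (cong (∣ A ∣ +_) (∣∁p∣≡n∸∣p∣ A)) (m+[n∸m]≡n (∣p∣≤n A))

-- weighted p s f = Σ_{T ⊆ Fin s} p^(s - |T|) · f T: (p+1)^s times the
-- expectation of f(T) when each element lies in T with probability 1/(p+1).
weighted : ℕ → ∀ s → (Subset s → ℕ) → ℕ
weighted p zero    f = f []
weighted p (suc s) f = weighted p s (f ∘ (true ∷_)) + p * weighted p s (f ∘ (false ∷_))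

weighted-cong : ∀ p s {f g : Subset s → ℕ} → (∀ T → f T ≡ g T) → weighted p s f ≡ weighted p s g
weighted-cong p zero    f≡g = f≡g []
weighted-cong p (suc s) f≡g =
  cong₂ (λ a b → a + p * b) (weighted-cong p s (f≡g ∘ (true ∷_))) (weighted-cong p s (f≡g ∘ (false ∷_)))

weighted-0 : ∀ p s → weighted p s (λ _ → 0) ≡ 0
weighted-0 p zero    = refl
weighted-0 p (suc s) = trans (cong (λ w → w + p * w) (weighted-0 p s)) (*-zeroʳ p)

weighted-+ : ∀ p s (f g : Subset s → ℕ) →
  weighted p s (λ T → f T + g T) ≡ weighted p s f + weighted p s g
weighted-+ p zero    f g = refl
weighted-+ p (suc s) f g =
  trans (cong₂ (λ a b → a + p * b) (weighted-+ p s (f ∘ (true ∷_)) (g ∘ (true ∷_)))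
                                   (weighted-+ p s (f ∘ (false ∷_)) (g ∘ (false ∷_))))
        (regroup (weighted p s (f ∘ (true ∷_))) (weighted p s (g ∘ (true ∷_)))
                 (weighted p s (f ∘ (false ∷_))) (weighted p s (g ∘ (false ∷_))) p)
  where
  regroup : ∀ a b c d p → (a + b) + p * (c + d) ≡ (a + p * c) + (b + p * d)
  regroup = solve-∀

weighted-Σ : ∀ p s {n} (h : Fin n → Subset s → ℕ) →
  weighted p s (λ T → Σ[ (λ v → h v T) ]) ≡ Σ[ (λ v → weighted p s (h v)) ]
weighted-Σ p s {zero}  h = weighted-0 p s
weighted-Σ p s {suc n} h =
  trans (weighted-+ p s (h fzero) (λ T → Σ[ (λ v → h (fsuc v) T) ]))
        (cong (weighted p s (h fzero) +_) (weighted-Σ p s (h ∘ fsuc)))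

split-bound : ∀ p Q {a b m} → a ≤ Q * m → b ≤ Q * m → a + p * b ≤ (suc p * Q) * m
split-bound p Q {m = m} a≤ b≤ = ≤-trans (+-mono-≤ a≤ (*-monoʳ-≤ p b≤)) (≤-reflexive (collect Q m p))
  where
  collect : ∀ Q m p → Q * m + p * (Q * m) ≡ (suc p * Q) * m
  collect = solve-∀

above-average : ∀ p s (f : Subset s → ℕ) → ∃ λ T → weighted p s f ≤ suc p ^ s * f T
above-average p zero    f = [] , ≤-reflexive (sym (+-identityʳ (f [])))
above-average p (suc s) f
  with above-average p s (f ∘ (true ∷_)) | above-average p s (f ∘ (false ∷_))
... | T₁ , h₁ | T₀ , h₀ with f (true ∷ T₁) ≤? f (false ∷ T₀)
...   | yes le  = false ∷ T₀ , split-bound p (suc p ^ s) (≤-trans h₁ (*-monoʳ-≤ (suc p ^ s) le)) h₀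
...   | no  nle = true ∷ T₁ , split-bound p (suc p ^ s) h₁ (≤-trans h₀ (*-monoʳ-≤ (suc p ^ s) (<⇒≤ (≰⇒> nle))))

hits : ℕ → ∀ {s} → Subset s → Subset s → ℕ
hits k A T = 𝟙 (∣ T ∩ A ∣ ≡ᵇ k)

-- An element outside A multiplies the weight by q = p + 1.
outside-factor : ∀ P Q p → P * Q + p * (P * Q) ≡ P * (suc p * Q)
outside-factor = solve-∀

-- Pr[T misses A] = (p/q)^|A|, cleared of denominators.
weighted-miss : ∀ p {s} (A : Subset s) →
  weighted p s (hits 0 A) ≡ p ^ ∣ A ∣ * suc p ^ ∣ ∁ A ∣
weighted-miss p []          = refl
weighted-miss p {suc s} (false ∷ A) rewrite weighted-miss p A = outside-factor (p ^ ∣ A ∣) (suc p ^ ∣ ∁ A ∣) p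
weighted-miss p {suc s} (true ∷ A) rewrite weighted-0 p s | weighted-miss p A =
  sym (*-assoc p (p ^ ∣ A ∣) (suc p ^ ∣ ∁ A ∣))

p*[a*p^[a-1]] : ∀ p a → p * (a * p ^ (a ∸ 1)) ≡ a * p ^ a
p*[a*p^[a-1]] p zero    = *-zeroʳ p
p*[a*p^[a-1]] p (suc a) = x∙yz≈y∙xz p (suc a) (p ^ a)

-- Pr[T meets A exactly once] = |A| · p^(|A|-1) / q^|A|, cleared of denominators.
weighted-once : ∀ p {s} (A : Subset s) →
  weighted p s (hits 1 A) ≡ ∣ A ∣ * p ^ (∣ A ∣ ∸ 1) * suc p ^ ∣ ∁ A ∣
weighted-once p []          = refl
weighted-once p {suc s} (false ∷ A) rewrite weighted-once p A =
  outside-factor (∣ A ∣ * p ^ (∣ A ∣ ∸ 1)) (suc p ^ ∣ ∁ A ∣) p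
weighted-once p {suc s} (true ∷ A) rewrite weighted-miss p A | weighted-once p A = begin
  P * Q + p * (a * p ^ (a ∸ 1) * Q)   ≡⟨ cong (P * Q +_) (sym (*-assoc p _ Q)) ⟩
  P * Q + p * (a * p ^ (a ∸ 1)) * Q   ≡⟨ cong (λ x → P * Q + x * Q) (p*[a*p^[a-1]] p a) ⟩
  P * Q + a * P * Q                   ≡⟨ collect P Q a ⟩
  suc a * P * Q                       ∎
  where
  open ≡-Reasoning
  a P Q : ℕ
  a = ∣ A ∣
  P = p ^ a
  Q = suc p ^ ∣ ∁ A ∣
  collect : ∀ P Q a → P * Q + a * P * Q ≡ suc a * P * Q
  collect = solve-∀

-- q(p - k) ≤ p(q - k) for q = p + 1: the inductive step of Bernoulli.
bernoulli-step : ∀ p k → suc p * (p ∸ k) ≤ p * (suc p ∸ k)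
bernoulli-step p       zero    = ≤-reflexive (*-comm (suc p) p)
bernoulli-step zero    (suc k) = z≤n
bernoulli-step (suc p) (suc k) = +-mono-≤ (∸-monoˡ-≤ k (n≤1+n p)) (bernoulli-step p k)

-- Bernoulli's inequality (1 - 1/q)^k ≥ 1 - k/q, cleared: q^k (q - k) ≤ q p^k.
bernoulli : ∀ p k → suc p ^ k * (suc p ∸ k) ≤ suc p * p ^ k
bernoulli p zero    = ≤-reflexive (trans (+-identityʳ _) (sym (*-identityʳ (suc p))))
bernoulli p (suc k) = begin
  (q * q ^ k) * (p ∸ k)       ≡⟨ xy∙z≈y∙xz q (q ^ k) (p ∸ k) ⟩
  q ^ k * (q * (p ∸ k))       ≤⟨ *-monoʳ-≤ (q ^ k) (bernoulli-step p k) ⟩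
  q ^ k * (p * (q ∸ k))       ≡⟨ x∙yz≈y∙xz (q ^ k) p (q ∸ k) ⟩
  p * (q ^ k * (q ∸ k))       ≤⟨ *-monoʳ-≤ p (bernoulli p k) ⟩
  p * (q * p ^ k)             ≡⟨ x∙yz≈y∙xz p q (p ^ k) ⟩
  q * (p * p ^ k)             ∎
  where
  open ≤-Reasoning
  q : ℕ
  q = suc p

-- gain q d = d(q + 1 - d); gain q d / q² bounds from below the probability
-- that a vertex of degree d is hit exactly once.
gain : ℕ → ℕ → ℕ
gain q d = d * (suc q ∸ d)

once-lower-bound : ∀ p a → suc p ^ a * gain (suc p) a ≤ (suc p * suc p) * (a * p ^ (a ∸ 1))
once-lower-bound p zero    = z≤n
once-lower-bound p (suc k) = begin
  (q * q ^ k) * (suc k * (q ∸ k))   ≡⟨ regroup₁ (q ^ k) (q ∸ k) k p ⟩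
  (q * suc k) * (q ^ k * (q ∸ k))   ≤⟨ *-monoʳ-≤ (q * suc k) (bernoulli p k) ⟩
  (q * suc k) * (q * p ^ k)         ≡⟨ regroup₂ (p ^ k) k p ⟩
  (q * q) * (suc k * p ^ k)         ∎
  where
  open ≤-Reasoning
  q : ℕ
  q = suc p
  regroup₁ : ∀ Q c k p → (suc p * Q) * (suc k * c) ≡ (suc p * suc k) * (Q * c)
  regroup₁ = solve-∀
  regroup₂ : ∀ P k p → (suc p * suc k) * (suc p * P) ≡ (suc p * suc p) * (suc k * P)
  regroup₂ = solve-∀

weighted-once-lower-bound : ∀ p {s} (A : Subset s) →
  suc p ^ s * gain (suc p) ∣ A ∣ ≤ (suc p * suc p) * weighted p s (hits 1 A)
weighted-once-lower-bound p {s} A = begin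
  q ^ s * gain q a                  ≡⟨ cong (λ e → q ^ e * gain q a) (sym (∣p∣+∣∁p∣ A)) ⟩
  q ^ (a + c) * gain q a            ≡⟨ cong (_* gain q a) (^-distribˡ-+-* q a c) ⟩
  q ^ a * q ^ c * gain q a          ≡⟨ xy∙z≈y∙xz (q ^ a) (q ^ c) (gain q a) ⟩
  q ^ c * (q ^ a * gain q a)        ≤⟨ *-monoʳ-≤ (q ^ c) (once-lower-bound p a) ⟩
  q ^ c * ((q * q) * X)             ≡⟨ x∙yz≈y∙zx (q ^ c) (q * q) X ⟩
  (q * q) * (X * q ^ c)             ≡⟨ cong ((q * q) *_) (sym (weighted-once p A)) ⟩
  (q * q) * weighted p s (hits 1 A) ∎
  where
  open ≤-Reasoning
  q a c X : ℕ
  q = suc p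
  a = ∣ A ∣
  c = ∣ ∁ A ∣
  X = a * p ^ (a ∸ 1)

-- Linearity of expectation: E|Γ¹(T)| = Σ_v Pr[v has exactly one neighbour in T].
weighted-Γ¹ : ∀ p {s n} (E : BipGraph s n) →
  weighted p s (∣_∣ ∘ Γ¹ E) ≡ Σ[ (λ v → weighted p s (hits 1 (nbrS E v))) ]
weighted-Γ¹ p {s} E =
  trans (weighted-cong p s (λ T → ∣tabulate∣ (λ v → deg E v T ≡ᵇ 1)))
        (weighted-Σ p s (λ v → hits 1 (nbrS E v)))

good-subset : ∀ {s n} (E : BipGraph s n) p →
  ∃ λ (S' : Subset s) → Σ[ (λ v → gain (suc p) (deg E v ⊤)) ] ≤ (suc p * suc p) * ∣ Γ¹ E S' ∣
good-subset {s} {n} E p with above-average p s (∣_∣ ∘ Γ¹ E)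
... | S' , average≤ = S' , *-cancelˡ-≤ (q ^ s) {{m^n≢0 q s}} (begin
  q ^ s * Σ[ g ]                        ≡⟨ sym (Σ-scale (q ^ s) g) ⟩
  Σ[ (λ v → q ^ s * g v) ]              ≤⟨ Σ-mono per-vertex ⟩
  Σ[ (λ v → (q * q) * once v) ]         ≡⟨ Σ-scale (q * q) once ⟩
  (q * q) * Σ[ once ]                   ≡⟨ cong ((q * q) *_) (sym (weighted-Γ¹ p E)) ⟩
  (q * q) * weighted p s (∣_∣ ∘ Γ¹ E)   ≤⟨ *-monoʳ-≤ (q * q) average≤ ⟩
  (q * q) * (q ^ s * ∣ Γ¹ E S' ∣)       ≡⟨ x∙yz≈y∙xz (q * q) (q ^ s) ∣ Γ¹ E S' ∣ ⟩
  q ^ s * ((q * q) * ∣ Γ¹ E S' ∣)       ∎)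
  where
  open ≤-Reasoning
  q : ℕ
  q = suc p
  g once : Fin n → ℕ
  g v    = gain q (deg E v ⊤)
  once v = weighted p s (hits 1 (nbrS E v))
  per-vertex : ∀ v → q ^ s * g v ≤ (q * q) * once v
  per-vertex v = ≤-trans (≤-reflexive (cong (λ A → q ^ s * gain q ∣ A ∣) (∩-identityˡ (nbrS E v))))
                         (weighted-once-lower-bound p (nbrS E v))

gain-plus-degree : ∀ q d → 1 ≤ d → q ≤ gain q d + d
gain-plus-degree q (suc e) _ = begin
  q                         ≤⟨ m≤n+m∸n q e ⟩
  e + (q ∸ e)               ≡⟨ +-comm e (q ∸ e) ⟩
  (q ∸ e) + e               ≤⟨ +-mono-≤ (m≤n*m (q ∸ e) (suc e)) (n≤1+n e) ⟩
  suc e * (q ∸ e) + suc e   ∎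
  where open ≤-Reasoning

Σ-gain-bound : ∀ {n} q (d : Fin n → ℕ) → (∀ v → 1 ≤ d v) → q * n ≤ Σ[ gain q ∘ d ] + Σ[ d ]
Σ-gain-bound {n} q d d≥1 = begin
  q * n                                ≡⟨ *-comm q n ⟩
  n * q                                ≡⟨ sym (Σ-const n q) ⟩
  Σ[ (λ (_ : Fin n) → q) ]             ≤⟨ Σ-mono (λ v → gain-plus-degree q (d v) (d≥1 v)) ⟩
  Σ[ (λ v → gain q (d v) + d v) ]      ≡⟨ Σ-+ (gain q ∘ d) d ⟩
  Σ[ gain q ∘ d ] + Σ[ d ]             ∎
  where open ≤-Reasoning

-- If 2D ≤ x ≤ 3D and G ≥ x - D, then x² ≤ 8DG: the quadratic 8D(x - D) - x²
-- is nonnegative on [2D, 3D].  Writing x = 2D + t and D = t + r, the gap is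
-- 7t² + 12tr + 4r².
quadratic-window : ∀ D x G → 2 * D ≤ x → x ≤ 3 * D → x ≤ G + D → x * x ≤ 8 * D * G
quadratic-window D x G 2D≤x x≤3D x≤G+D with m≤n⇒∃[o]m+o≡n 2D≤x
... | t , refl with m≤n⇒∃[o]m+o≡n (+-cancelˡ-≤ (2 * D) t D (≤-trans x≤3D (≤-reflexive (+-comm D (2 * D)))))
...   | r , refl = begin
  x * x                                         ≤⟨ m≤m+n (x * x) (7 * t * t + 12 * t * r + 4 * r * r) ⟩
  x * x + (7 * t * t + 12 * t * r + 4 * r * r)  ≡⟨ expand t r ⟩
  8 * (t + r) * (2 * t + r)                     ≤⟨ *-monoʳ-≤ (8 * (t + r)) G≥x-D ⟩
  8 * (t + r) * G                               ∎
  where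
  open ≤-Reasoning
  expand : ∀ t r → (2 * (t + r) + t) * (2 * (t + r) + t) + (7 * t * t + 12 * t * r + 4 * r * r)
                   ≡ 8 * (t + r) * (2 * t + r)
  expand = solve-∀
  shuffle : ∀ t r → 2 * t + r + (t + r) ≡ 2 * (t + r) + t
  shuffle = solve-∀
  G≥x-D : 2 * t + r ≤ G
  G≥x-D = +-cancelʳ-≤ (t + r) (2 * t + r) G (≤-trans (≤-reflexive (shuffle t r)) x≤G+D)

-- For 0 < n ≤ D some positive multiple q·n lies in [2D, 3D]: take q = ⌊3D/n⌋.
multiple-in-window : ∀ n D → suc n ≤ D → ∃ λ p → 2 * D ≤ suc p * suc n × suc p * suc n ≤ 3 * D
multiple-in-window n D n<D = positive (3 * D / suc n) lower (m/n*n≤m (3 * D) (suc n))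
  where
  open ≤-Reasoning
  -- 3D = 3D mod n + q·n < D + q·n
  lower : 2 * D ≤ 3 * D / suc n * suc n
  lower = +-cancelˡ-≤ D (2 * D) _ (begin
    D + 2 * D                                ≡⟨ m≡m%n+[m/n]*n (3 * D) (suc n) ⟩
    3 * D % suc n + 3 * D / suc n * suc n    ≤⟨ +-monoˡ-≤ _ (≤-trans (<⇒≤ (m%n<n (3 * D) (suc n))) n<D) ⟩
    D + 3 * D / suc n * suc n                ∎)
  positive : ∀ q → 2 * D ≤ q * suc n → q * suc n ≤ 3 * D →
             ∃ λ p → 2 * D ≤ suc p * suc n × suc p * suc n ≤ 3 * D
  positive zero    2D≤0 _ with ≤-trans n<D (≤-trans (m≤m+n D (D + 0)) 2D≤0)
  ... | ()
  positive (suc p) 2D≤qn qn≤3D = p , 2D≤qn , qn≤3D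

N-degree-positive : ∀ {s n} (E : BipGraph s n) → NoIsolated E → ∀ v → 1 ≤ deg E v ⊤
N-degree-positive E (_ , N-has-nbr) v with N-has-nbr v
... | u , Euv≡true = ≤-trans (∣tabulate∣-positive (λ u → E u v) u Euv≡true)
                             (≤-reflexive (cong ∣_∣ (sym (∩-identityˡ (nbrS E v)))))

γ≤degSum : ∀ {s n} (E : BipGraph s n) → (∀ v → 1 ≤ deg E v ⊤) → n ≤ degSum E
γ≤degSum {n = n} E deg≥1 =
  ≤-trans (≤-reflexive (trans (sym (*-identityʳ n)) (sym (Σ-const n 1)))) (Σ-mono deg≥1)

sampling-bound : ∀ {s n} (E : BipGraph s n) p → (∀ v → 1 ≤ deg E v ⊤) →
  2 * degSum E ≤ suc p * n → suc p * n ≤ 3 * degSum E →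
  ∃ λ (S' : Subset s) → n * n ≤ 8 * degSum E * ∣ Γ¹ E S' ∣
sampling-bound {n = n} E p deg≥1 2D≤qγ qγ≤3D with good-subset E p
... | S' , Σgain≤q²Γ¹ = S' , *-cancelˡ-≤ (q * q) (begin
  (q * q) * (n * n)         ≡⟨ square q n ⟩
  (q * n) * (q * n)         ≤⟨ quadratic-window D (q * n) Σgain 2D≤qγ qγ≤3D
                                 (Σ-gain-bound q (λ v → deg E v ⊤) deg≥1) ⟩
  8 * D * Σgain             ≤⟨ *-monoʳ-≤ (8 * D) Σgain≤q²Γ¹ ⟩
  8 * D * ((q * q) * Γ)     ≡⟨ x∙yz≈y∙xz (8 * D) (q * q) Γ ⟩
  (q * q) * (8 * D * Γ)     ∎)
  where
  open ≤-Reasoning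
  q D Σgain Γ : ℕ
  q     = suc p
  D     = degSum E
  Σgain = Σ[ (λ v → gain q (deg E v ⊤)) ]
  Γ     = ∣ Γ¹ E S' ∣
  square : ∀ q n → (q * q) * (n * n) ≡ (q * n) * (q * n)
  square = solve-∀

lemmaA3 : ∀ {s n} (E : BipGraph s n) → NoIsolated E →
    ∃ λ (S' : Subset s) → n * n ≤ 8 * degSum E * ∣ Γ¹ E S' ∣
lemmaA3 {n = zero}  E _          = ⊤ , z≤n
lemmaA3 {n = suc n} E noIsolated =
  let p , 2D≤qγ , qγ≤3D = multiple-in-window n (degSum E) (γ≤degSum E deg≥1)
  in  sampling-bound E p deg≥1 2D≤qγ qγ≤3D
  where
  deg≥1 : ∀ v → 1 ≤ deg E v ⊤
  deg≥1 = N-degree-positive E noIsolated
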